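{- The following recursion holds: \begin{equation*} \begin{aligned} &\hat{Q}_{0{\bm{v}},0{\bm{w}}}=t^{ -|{\bm{v}}|}\hat{Q}_{{\bm{v}}\times,{\bm{w}}\times}+qt^{ -|{\bm{v}}|}\hat{Q}_{{\bm{v}}0,{\bm{w}}0},\\ &\hat{Q}_{\times{\bm{v}},0{\bm{w}}}=\hat{Q}_{{\bm{v}}\times,{\bm{w}}\bullet},\\ &\hat{Q}_{0{\bm{v}},\times{\bm{w}}}=\hat{Q}_{{\bm{v}}\bullet,{\bm{w}}\times},\\ &\hat{Q}_{\times{\bm{v}},\times{\bm{w}}}=(t^{|{\bm{v}}|}+a)\hat{Q}_{{\bm{v}}\bullet,{\bm{w}}\bullet},\\ &\hat{Q}_{\bullet{\bm{v}},\bullet{\bm{w}}}=\hat{Q}_{{\bm{v}}\bullet,{\bm{w}}\bullet}. \end{aligned} \end{equation*}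
   Context: Let $M,N$ be positive integers, $I_{M,N}$ the set of subsets $\Delta\subset\mathbb{Z}_{\ge0}$ with $\Delta+N\subset\Delta$, $\Delta+M\subset\Delta$ and finite complement $\overline{\Delta}$. Let $\lambda(\Delta)$ be the number of $N$-generators ($a\in\Delta$, $a-N\notin\Delta$) in $[N,N+M-1]$, and $\lambda_k(\Delta)$ the number of $N$-generators in $[k+N+1,k+N+M]$. $\mathrm{area}'(\Delta)=\sharp(\overline{\Delta}\cap\mathbb{Z}_{\ge N+M})$, $\mathrm{codinv}'(\Delta)=\sum_{a\ N\text{ -generator}}\sharp([a,a+M-1]\cap\overline{\Delta}\cap\mathbb{Z}_{\ge N+M})-\lambda(\Delta)(\lambda(\Delta)-1)/2$. A double cogenerator is $k\in\overline{\Delta}$ with $k+N,k+M\in\Delta$. For admissible $\mathbf{u}\in\{0,1\}^{N+M}$ (i.e. $I_{\mathbf{u}}=\{\Delta\in I_{M,N}:\forall\,0\le i<N+M,\ i\in\Delta\Leftrightarrow u_i=1\}\ne\emptyset$), $\hat Q_{\mathbf{u}}(q,t,a)=\sum_{\Delta\in I_{\mathbf{u}}}t^{ -\mathrm{codinv}'(\Delta)}q^{\mathrm{area}'(\Delta)}\prod_{k\text{ double cogenerator}}(1+at^{ -\lambda_k(\Delta)})$, and $\hat Q_{\bm{v},\bm{w}}:=\hat Q_{\mathbf{u}}$, where $\bm{v}\in\{0,\bullet,\times\}^M$ has $v_i=0$ if $u_{N+i}=0$, $\bullet$ if $u_{N+i}=u_i=1$, $\times$ if $u_{N+i}=1,u_i=0$,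 and $\bm{w}\in\{0,\bullet,\times\}^N$ is defined likewise with $M$ in place of $N$. $|\bm{v}|$ is the number of $\times$'s in $\bm{v}$. -}

module Defs where

open import Data.Nat using (ℕ; zero; suc; _+_; _*_; _∸_; _≤ᵇ_; _<ᵇ_)
open import Data.Nat.DivMod using (_/_)
open import Data.Integer as ℤ using (ℤ; +_)
open import Data.Bool using (Bool; true; false; _∧_; _∨_; not; if_then_else_)
open import Data.List using (List; []; _∷_; _++_; map; foldr)
open import Data.Vec using (Vec; []; _∷_; tabulate)
open import Data.Fin using (toℕ)
open import Relation.Binary.PropositionalEquality using (_≡_)

-- Formal series in q, t^{±1}, a with natural-number coefficients,
-- represented by their coefficient function:
--   F d i j  = coefficient of  q^d t^i a^j .

Ser : Set
Ser = ℕ → ℤ → ℕ → ℕ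

zeroS : Ser
zeroS _ _ _ = 0

oneS : Ser
oneS zero (+ zero) zero = 1
oneS _    _        _    = 0

infixl 6 _⊕_
_⊕_ : Ser → Ser → Ser
(F ⊕ G) d i j = F d i j + G d i j

mono : ℕ → ℤ → ℕ → Ser → Ser
mono dq dt da F d i j =
  if (dq ≤ᵇ d) ∧ (da ≤ᵇ j) then F (d ∸ dq) (i ℤ.- dt) (j ∸ da) else 0

infix 4 _≈S_
_≈S_ : Ser → Ser → Set
F ≈S G = ∀ d i j → F d i j ≡ G d i j

sumListS : {X : Set} → List X → (X → Ser) → Ser
sumListS []       f = zeroS
sumListS (x ∷ xs) f = f x ⊕ sumListS xs f

sumTo : ℕ → (ℕ → ℕ) → ℕ
sumTo zero    f = 0
sumTo (suc B) f = sumTo B f + f B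

countTo : ℕ → (ℕ → Bool) → ℕ
countTo B p = sumTo B (λ x → if p x then 1 else 0)

filterTo : ℕ → (ℕ → Bool) → List ℕ
filterTo zero    p = []
filterTo (suc B) p = filterTo B p ++ (if p B then B ∷ [] else [])

allTo : ℕ → (ℕ → Bool) → Bool
allTo zero    p = true
allTo (suc B) p = allTo B p ∧ p B

allVecs : (B : ℕ) → List (Vec Bool B)
allVecs zero    = [] ∷ []
allVecs (suc B) = map (true ∷_) (allVecs B) ++ map (false ∷_) (allVecs B)

-- Subsets Δ ⊆ ℤ_{≥0} with finite complement, encoded by a vector
-- s ∈ {0,1}^B : x ∈ Δ iff (x < B and s_x = 1) or x ≥ B.
-- Every Δ with complement ⊆ [0,B) has exactly one such encoding.

memV : {B : ℕ} → Vec Bool B → ℕ → Bool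
memV []      _       = true
memV (b ∷ s) zero    = b
memV (b ∷ s) (suc x) = memV s x

-- entry of a boolean vector (false outside the range; never used there)
at : {L : ℕ} → Vec Bool L → ℕ → Bool
at []      _       = false
at (b ∷ s) zero    = b
at (b ∷ s) (suc x) = at s x

module _ (M N : ℕ) where

  -- In what follows D is the membership function of Δ and B a bound
  -- with [B,∞) ⊆ Δ (so the complement lies in [0,B)).

  -- Δ + N ⊆ Δ and Δ + M ⊆ Δ  (only x < B needs checking since [B,∞) ⊆ Δ)
  inIMN : (ℕ → Bool) → ℕ → Bool
  inIMN D B = allTo B (λ x → not (D x) ∨ (D (x + N) ∧ D (x + M)))

  hasPrefix : (ℕ → Bool) → Vec Bool (N + M) → Bool
  hasPrefix D u = allTo (N + M) (λ i → if D i then at u i else not (at u i))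

  -- N-generator: a ∈ Δ, a - N ∉ Δ (a - N < 0 counts as ∉ Δ)
  isGen : (ℕ → Bool) → ℕ → Bool
  isGen D a = D a ∧ ((a <ᵇ N) ∨ not (D (a ∸ N)))

  coHigh : (ℕ → Bool) → ℕ → Bool
  coHigh D x = (N + M ≤ᵇ x) ∧ not (D x)

  area' : (ℕ → Bool) → ℕ → ℕ
  area' D B = countTo B (coHigh D)

  -- λ(Δ): number of N-generators in [N, N+M-1]  (all generators are < B+N)
  lam : (ℕ → Bool) → ℕ → ℕ
  lam D B = countTo (B + N) (λ a → isGen D a ∧ (N ≤ᵇ a) ∧ (a <ᵇ N + M))

  lamk : (ℕ → Bool) → ℕ → ℕ → ℕ
  lamk D B k = countTo (B + N)
    (λ a → isGen D a ∧ (suc (k + N) ≤ᵇ a) ∧ (a ≤ᵇ k + N + M))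

  codinv' : (ℕ → Bool) → ℕ → ℤ
  codinv' D B =
    + sumTo (B + N) (λ a → if isGen D a
                             then countTo B (λ x → (a ≤ᵇ x) ∧ (x <ᵇ a + M) ∧ coHigh D x)
                             else 0)
    ℤ.- + ((lam D B * (lam D B ∸ 1)) / 2)

  -- double cogenerators: k ∉ Δ, k+N ∈ Δ, k+M ∈ Δ  (necessarily k < B)
  dcogens : (ℕ → Bool) → ℕ → List ℕ
  dcogens D B = filterTo B (λ k → not (D k) ∧ D (k + N) ∧ D (k + M))

  contrib : (ℕ → Bool) → ℕ → Ser
  contrib D B =
    mono (area' D B) (ℤ.- codinv' D B) 0
      (foldr (λ k F → F ⊕ mono 0 (ℤ.- (+ lamk D B k)) 1 F) oneS (dcogens D B))

  -- If area'(Δ) = d then the complement of Δ lies in [0, N+M+d·N)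
  -- (a cogenerator c ≥ N+M forces c, c-N, c-2N, … ≥ N+M out of Δ).
  bound : ℕ → ℕ
  bound d = N + M + d * N

  -- \hat Q_u :  its q^d-coefficient is the sum over all Δ ∈ I_u with
  -- area'(Δ) = d, all of which have complement inside [0, bound d).
  Qhat : Vec Bool (N + M) → Ser
  Qhat u d = sumListS (allVecs (bound d))
    (λ s → if inIMN (memV s) (bound d) ∧ hasPrefix (memV s) u
             then contrib (memV s) (bound d)
             else zeroS) d

data Sym : Set where
  o : Sym
  ● : Sym
  ✗ : Sym

sym : Bool → Bool → Sym
sym false _     = o
sym true  true  = ●
sym true  false = ✗

_==S_ : Sym → Sym → Bool
o ==S o = true
● ==S ● = true
✗ ==S ✗ = true
_ ==S _ = false

eqV : {L : ℕ} → Vec Sym L → Vec Sym L → Bool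
eqV []      []      = true
eqV (x ∷ v) (y ∷ w) = (x ==S y) ∧ eqV v w

crosses : {L : ℕ} → Vec Sym L → ℕ
crosses []      = 0
crosses (✗ ∷ v) = suc (crosses v)
crosses (_ ∷ v) = crosses v

module _ (M N : ℕ) where

  vOf : Vec Bool (N + M) → Vec Sym M
  vOf u = tabulate (λ i → sym (at u (N + toℕ i)) (at u (toℕ i)))

  wOf : Vec Bool (N + M) → Vec Sym N
  wOf u = tabulate (λ i → sym (at u (M + toℕ i)) (at u (toℕ i)))

  -- \hat Q_{v,w} := \hat Q_u for u with labels (v,w).  Summing over all u
  -- with these labels: non-admissible u contribute 0 (I_u = ∅), and at most
  -- one admissible u has given labels (v_i = 0 forces u_i = 0, etc.).
  QVW : Vec Sym M → Vec Sym N → Ser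
  QVW v w = sumListS (allVecs (N + M))
    (λ u → if eqV (vOf u) v ∧ eqV (wOf u) w then Qhat M N u else zeroS)

module Submission where

-- Let Δ′ = (Δ - 1) ∩ ℤ_{≥0} and let b, p, q, r record whether 0, N, M, N+M lie in Δ. The labels
-- of Δ are read off from 0, …, N+M-1 and those of Δ′ from 1, …, N+M, so the first letters of
-- (v, w) are determined by (b, p, q) and the last letters of the labels of Δ′ by (p, q, r); and
-- Δ ∈ I_{M,N} iff Δ′ ∈ I_{M,N} and 0 ∈ Δ implies N, M ∈ Δ. Comparing area', codinv', λ and the
-- double cogenerators of Δ and Δ′ shows that the weight of Δ is that of Δ′ times a monomial
-- depending only on (b, p, q, r) and on |v|, the number of N-generators of Δ in (N, N+M). Each
-- identity then follows by summing over Δ′ and checking the five possible values of (p, q, r).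

open import Defs renaming (sym to symb)
open import Data.Nat using (ℕ; zero; suc; _+_; _*_; _∸_; _≤ᵇ_; _<ᵇ_; _≤_; _<_; z≤n; s≤s; s≤s⁻¹)
open import Data.Nat.Properties
open import Data.Nat.DivMod using (_/_; +-distrib-/-∣ʳ; m*n/n≡m)
open import Data.Nat.Divisibility using (divides)
open import Data.Integer as ℤ using (ℤ; +_; -_)
import Data.Integer.Properties as ℤP
open import Data.Bool using (Bool; true; false; _∧_; _∨_; not; if_then_else_)
open import Data.Bool.Properties using (∧-zeroʳ; ∧-identityʳ; ∧-assoc; ∧-comm; ∧-commutativeMonoid)
open import Data.List using (List; []; _∷_; _++_; map; foldr)
open import Data.List.Properties using (++-assoc; ++-identityʳ; map-++)
open import Data.Vec using (Vec; []; _∷_; _∷ʳ_; tabulate)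
open import Data.Fin using (toℕ)
open import Data.Product using (_×_; _,_)
open import Function using (id)
open import Relation.Binary.PropositionalEquality
open import Relation.Nullary using (yes; no; contradiction)
open import Relation.Binary.Definitions using (tri<; tri≈; tri>)
open import Algebra.Bundles using (CommutativeMonoid)
import Algebra.Properties.CommutativeSemigroup as CommSemigroupProperties
open CommSemigroupProperties +-commutativeSemigroup using ()
  renaming (interchange to +-interchange; xy∙z≈xz∙y to +-right-comm)
open CommSemigroupProperties (CommutativeMonoid.commutativeSemigroup ∧-commutativeMonoid) using ()
  renaming (interchange to ∧-interchange)

infixr 5 _■_
_■_ : {A : Set} {x y z : A} → x ≡ y → y ≡ z → x ≡ z
_■_ = trans

ind : Bool → ℕ
ind b = if b then 1 else 0

∧-≡-trueˡ : ∀ {a b} → (a ∧ b) ≡ true → a ≡ true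
∧-≡-trueˡ {true} _ = refl

∧-≡-trueʳ : ∀ {a b} → (a ∧ b) ≡ true → b ≡ true
∧-≡-trueʳ {true} e = e

<⇒<ᵇ≡true : ∀ {a b} → a < b → (a <ᵇ b) ≡ true
<⇒<ᵇ≡true {zero} {suc b} _ = refl
<⇒<ᵇ≡true {suc a} {suc b} (s≤s p) = <⇒<ᵇ≡true p

≥⇒<ᵇ≡false : ∀ {a b} → b ≤ a → (a <ᵇ b) ≡ false
≥⇒<ᵇ≡false {a} {zero} _ = refl
≥⇒<ᵇ≡false {suc a} {suc b} (s≤s p) = ≥⇒<ᵇ≡false p

≤⇒≤ᵇ≡true : ∀ {a b} → a ≤ b → (a ≤ᵇ b) ≡ true
≤⇒≤ᵇ≡true {zero} _ = refl
≤⇒≤ᵇ≡true {suc a} p = <⇒<ᵇ≡true p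

>⇒≤ᵇ≡false : ∀ {a b} → b < a → (a ≤ᵇ b) ≡ false
>⇒≤ᵇ≡false {suc a} (s≤s p) = ≥⇒<ᵇ≡false p

<ᵇ≡true⇒< : ∀ a b → (a <ᵇ b) ≡ true → a < b
<ᵇ≡true⇒< zero (suc b) _ = s≤s z≤n
<ᵇ≡true⇒< (suc a) (suc b) e = s≤s (<ᵇ≡true⇒< a b e)

≤ᵇ≡true⇒≤ : ∀ a b → (a ≤ᵇ b) ≡ true → a ≤ b
≤ᵇ≡true⇒≤ zero b _ = z≤n
≤ᵇ≡true⇒≤ (suc a) b e = <ᵇ≡true⇒< a b e

≤ᵇ-suc : ∀ a x → (suc a ≤ᵇ suc x) ≡ (a ≤ᵇ x)
≤ᵇ-suc zero x = refl
≤ᵇ-suc (suc a) x = refl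

≤ᵇ≡<ᵇ-suc : ∀ a x → (a ≤ᵇ x) ≡ (a <ᵇ suc x)
≤ᵇ≡<ᵇ-suc zero x = refl
≤ᵇ≡<ᵇ-suc (suc a) x = refl

<ᵇ-suc-≢ : ∀ k x → x ≢ k → (k <ᵇ suc x) ≡ (k <ᵇ x)
<ᵇ-suc-≢ k x x≢k with <-cmp k x
... | tri< k<x _ _ = <⇒<ᵇ≡true (m≤n⇒m≤1+n k<x) ■ sym (<⇒<ᵇ≡true k<x)
... | tri≈ _ k≡x _ = contradiction (sym k≡x) x≢k
... | tri> _ _ k>x = ≥⇒<ᵇ≡false k>x ■ sym (≥⇒<ᵇ≡false (<⇒≤ k>x))

if-cong : ∀ {b c : Bool} {x y : ℕ} → b ≡ c → (c ≡ true → x ≡ y) →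
          (if b then x else 0) ≡ (if c then y else 0)
if-cong {true} refl h = h refl
if-cong {false} refl h = refl

if-∧ : ∀ a b (x : ℕ) → (if a ∧ b then x else 0) ≡ (if a then (if b then x else 0) else 0)
if-∧ true b x = refl
if-∧ false b x = refl

if-+ : ∀ c x y → (if c then x + y else 0) ≡ (if c then x else 0) + (if c then y else 0)
if-+ true x y = refl
if-+ false x y = refl

if-∧-+ : ∀ a b₁ b₂ (x₁ x₂ : ℕ) →
         (if a ∧ b₁ then x₁ else 0) + (if a ∧ b₂ then x₂ else 0)
         ≡ (if a then (if b₁ then x₁ else 0) + (if b₂ then x₂ else 0) else 0)
if-∧-+ true b₁ b₂ x₁ x₂ = refl
if-∧-+ false b₁ b₂ x₁ x₂ = refl

sumTo-cong : ∀ B {f g : ℕ → ℕ} → (∀ x → x < B → f x ≡ g x) → sumTo B f ≡ sumTo B g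
sumTo-cong zero h = refl
sumTo-cong (suc B) h = cong₂ _+_ (sumTo-cong B (λ x x<B → h x (m≤n⇒m≤1+n x<B))) (h B ≤-refl)

sumTo-front : ∀ B (f : ℕ → ℕ) → sumTo (suc B) f ≡ f 0 + sumTo B (λ x → f (suc x))
sumTo-front zero f = sym (+-identityʳ (f 0))
sumTo-front (suc B) f = cong (_+ f (suc B)) (sumTo-front B f) ■ +-assoc (f 0) _ _

sumTo-zero : ∀ B {f : ℕ → ℕ} → (∀ x → x < B → f x ≡ 0) → sumTo B f ≡ 0
sumTo-zero zero h = refl
sumTo-zero (suc B) h = cong₂ _+_ (sumTo-zero B (λ x x<B → h x (m≤n⇒m≤1+n x<B))) (h B ≤-refl)

sumTo-+ : ∀ B (f g : ℕ → ℕ) → sumTo B (λ x → f x + g x) ≡ sumTo B f + sumTo B g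
sumTo-+ zero f g = refl
sumTo-+ (suc B) f g =
  cong (_+ (f B + g B)) (sumTo-+ B f g) ■ +-interchange (sumTo B f) (sumTo B g) (f B) (g B)

sumTo-if : ∀ B b (f : ℕ → ℕ) → sumTo B (λ a → if b then 0 else f a) ≡ (if b then 0 else sumTo B f)
sumTo-if B true f = sumTo-zero B (λ _ _ → refl)
sumTo-if B false f = refl

sumTo-split : ∀ A C (f : ℕ → ℕ) → sumTo (A + C) f ≡ sumTo A f + sumTo C (λ i → f (A + i))
sumTo-split A zero f rewrite +-identityʳ A = sym (+-identityʳ _)
sumTo-split A (suc C) f rewrite +-suc A C | sumTo-split A C f = +-assoc (sumTo A f) _ _

sumTo-mono : ∀ A C (f : ℕ → ℕ) → A ≤ C → sumTo A f ≤ sumTo C f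
sumTo-mono A C f A≤C =
  subst (sumTo A f ≤_) (sym (cong (λ z → sumTo z f) (sym (m+[n∸m]≡n A≤C)) ■ sumTo-split A (C ∸ A) f))
        (m≤m+n _ _)

sumTo-extend : ∀ B B₂ {f : ℕ → ℕ} → B ≤ B₂ → (∀ x → B ≤ x → f x ≡ 0) → sumTo B₂ f ≡ sumTo B f
sumTo-extend B B₂ {f} B≤B₂ h =
  cong (λ z → sumTo z f) (sym (m+[n∸m]≡n B≤B₂))
  ■ sumTo-split B (B₂ ∸ B) f
  ■ cong (_+_ (sumTo B f)) (sumTo-zero (B₂ ∸ B) (λ x _ → h (B + x) (m≤m+n B x)))
  ■ +-identityʳ _

sumTo-exchange-at : ∀ B x₀ {f g : ℕ → ℕ} → x₀ < B → (∀ x → x < B → x ≢ x₀ → f x ≡ g x) →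
                    sumTo B f + g x₀ ≡ sumTo B g + f x₀
sumTo-exchange-at (suc B) x₀ {f} {g} x₀<B h with x₀ ≟ B
... | yes refl =
  +-assoc (sumTo B f) (f B) (g B)
  ■ cong₂ _+_ (sumTo-cong B (λ x x<B → h x (m≤n⇒m≤1+n x<B) (λ e → <-irrefl e x<B))) (+-comm (f B) (g B))
  ■ sym (+-assoc (sumTo B g) (g B) (f B))
... | no x₀≢B =
  +-right-comm (sumTo B f) (f B) (g x₀)
  ■ cong₂ _+_ (sumTo-exchange-at B x₀ (≤∧≢⇒< (s≤s⁻¹ x₀<B) x₀≢B) (λ x x<B → h x (m≤n⇒m≤1+n x<B)))
              (h B ≤-refl (λ B≡x₀ → x₀≢B (sym B≡x₀)))
  ■ +-right-comm (sumTo B g) (f x₀) (g B)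

countTo-suc-false : ∀ B {p : ℕ → Bool} → p B ≡ false → countTo (suc B) p ≡ countTo B p
countTo-suc-false B e rewrite e = +-identityʳ _

allTo-front : ∀ B (p : ℕ → Bool) → allTo (suc B) p ≡ (p 0 ∧ allTo B (λ x → p (suc x)))
allTo-front zero p = sym (∧-identityʳ (p 0))
allTo-front (suc B) p rewrite allTo-front B p = ∧-assoc (p 0) (allTo B (λ x → p (suc x))) (p (suc B))

allTo-sound : ∀ B {p : ℕ → Bool} → allTo B p ≡ true → ∀ x → x < B → p x ≡ true
allTo-sound (suc B) {p} e x x<B with x ≟ B
... | yes refl = ∧-≡-trueʳ {allTo B p} e
... | no x≢B = allTo-sound B (∧-≡-trueˡ e) x (≤∧≢⇒< (s≤s⁻¹ x<B) x≢B)

allTo-cong : ∀ B {p q : ℕ → Bool} → (∀ x → x < B → p x ≡ q x) → allTo B p ≡ allTo B q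
allTo-cong zero h = refl
allTo-cong (suc B) h = cong₂ _∧_ (allTo-cong B (λ x x<B → h x (m≤n⇒m≤1+n x<B))) (h B ≤-refl)

allTo-suc-true : ∀ B {p : ℕ → Bool} → p B ≡ true → allTo (suc B) p ≡ allTo B p
allTo-suc-true B {p} e rewrite e = ∧-identityʳ (allTo B p)

filterTo-front : ∀ B (p : ℕ → Bool) →
  filterTo (suc B) p ≡ (if p 0 then 0 ∷ [] else []) ++ map suc (filterTo B (λ x → p (suc x)))
filterTo-front zero p with p 0
... | true = refl
... | false = refl
filterTo-front (suc B) p rewrite filterTo-front B p
  | map-++ suc (filterTo B (λ x → p (suc x))) (if p (suc B) then B ∷ [] else [])
  = ++-assoc (if p 0 then 0 ∷ [] else []) _ _
    ■ cong (λ z → (if p 0 then 0 ∷ [] else []) ++ (map suc (filterTo B (λ x → p (suc x))) ++ z))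
           (singleton-suc (p (suc B)))
  where
  singleton-suc : ∀ c → (if c then suc B ∷ [] else []) ≡ map suc (if c then B ∷ [] else [])
  singleton-suc true = refl
  singleton-suc false = refl

filterTo-cong : ∀ B {p q : ℕ → Bool} → (∀ x → x < B → p x ≡ q x) → filterTo B p ≡ filterTo B q
filterTo-cong zero h = refl
filterTo-cong (suc B) h =
  cong₂ _++_ (filterTo-cong B (λ x x<B → h x (m≤n⇒m≤1+n x<B))) (cong (λ c → if c then B ∷ [] else []) (h B ≤-refl))

filterTo-suc-false : ∀ B {p : ℕ → Bool} → p B ≡ false → filterTo (suc B) p ≡ filterTo B p
filterTo-suc-false B {p} e rewrite e = ++-identityʳ (filterTo B p)

sumList : {X : Set} → List X → (X → ℕ) → ℕ
sumList [] f = 0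
sumList (x ∷ xs) f = f x + sumList xs f

sumListS-apply : {X : Set} (xs : List X) (f : X → Ser) → ∀ d i j →
                 sumListS xs f d i j ≡ sumList xs (λ x → f x d i j)
sumListS-apply [] f d i j = refl
sumListS-apply (x ∷ xs) f d i j = cong (_+_ (f x d i j)) (sumListS-apply xs f d i j)

sumList-++ : {X : Set} (xs ys : List X) (f : X → ℕ) → sumList (xs ++ ys) f ≡ sumList xs f + sumList ys f
sumList-++ [] ys f = refl
sumList-++ (x ∷ xs) ys f rewrite sumList-++ xs ys f = sym (+-assoc (f x) _ _)

sumList-map : {X Y : Set} (g : X → Y) (xs : List X) (f : Y → ℕ) →
              sumList (map g xs) f ≡ sumList xs (λ x → f (g x))
sumList-map g [] f = refl
sumList-map g (x ∷ xs) f = cong (_+_ (f (g x))) (sumList-map g xs f)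

sumList-cong : {X : Set} (xs : List X) {f g : X → ℕ} → (∀ x → f x ≡ g x) → sumList xs f ≡ sumList xs g
sumList-cong [] h = refl
sumList-cong (x ∷ xs) h = cong₂ _+_ (h x) (sumList-cong xs h)

sumList-zero : {X : Set} (xs : List X) {f : X → ℕ} → (∀ x → f x ≡ 0) → sumList xs f ≡ 0
sumList-zero [] h = refl
sumList-zero (x ∷ xs) h rewrite h x = sumList-zero xs h

sumList-+ : {X : Set} (xs : List X) (f g : X → ℕ) →
            sumList xs (λ x → f x + g x) ≡ sumList xs f + sumList xs g
sumList-+ [] f g = refl
sumList-+ (x ∷ xs) f g rewrite sumList-+ xs f g = +-interchange (f x) (g x) (sumList xs f) (sumList xs g)

sumList-swap : {X Y : Set} (xs : List X) (ys : List Y) (g : X → Y → ℕ) →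
  sumList xs (λ x → sumList ys (g x)) ≡ sumList ys (λ y → sumList xs (λ x → g x y))
sumList-swap [] ys g = sym (sumList-zero ys (λ _ → refl))
sumList-swap (x ∷ xs) ys g rewrite sumList-swap xs ys g =
  sym (sumList-+ ys (g x) (λ y → sumList xs (λ x′ → g x′ y)))

sumList-if : {X : Set} (xs : List X) (c : Bool) (f : X → ℕ) →
  sumList xs (λ x → if c then f x else 0) ≡ (if c then sumList xs f else 0)
sumList-if xs true f = refl
sumList-if xs false f = sumList-zero xs (λ _ → refl)

sumList-guard : {X : Set} (xs : List X) (c : X → Bool) (g : Bool) (Y : X → ℕ) →
  (if g then sumList xs (λ x → if c x then Y x else 0) else 0)
  ≡ sumList xs (λ x → if c x then (if g then Y x else 0) else 0)
sumList-guard xs c true Y = refl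
sumList-guard xs c false Y = sym (sumList-zero xs (λ x → zero-either (c x)))
  where
  zero-either : ∀ b → (if b then 0 else 0) ≡ 0
  zero-either true = refl
  zero-either false = refl

allVecs-cons-split : ∀ L (F : Vec Bool (suc L) → ℕ) →
  sumList (allVecs (suc L)) F ≡ sumList (allVecs L) (λ t → F (true ∷ t)) + sumList (allVecs L) (λ t → F (false ∷ t))
allVecs-cons-split L F =
  sumList-++ (map (true ∷_) (allVecs L)) _ F
  ■ cong₂ _+_ (sumList-map (true ∷_) (allVecs L) F) (sumList-map (false ∷_) (allVecs L) F)

allVecs-snoc-split : ∀ L (F : Vec Bool (suc L) → ℕ) →
  sumList (allVecs (suc L)) F ≡ sumList (allVecs L) (λ t → F (t ∷ʳ true)) + sumList (allVecs L) (λ t → F (t ∷ʳ false))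
allVecs-snoc-split zero F rewrite +-identityʳ (F (true ∷ [])) | +-identityʳ (F (false ∷ [])) = refl
allVecs-snoc-split (suc L) F =
  allVecs-cons-split (suc L) F
  ■ cong₂ _+_ (allVecs-snoc-split L (λ t → F (true ∷ t))) (allVecs-snoc-split L (λ t → F (false ∷ t)))
  ■ +-interchange (Σ (λ t → F ((true ∷ t) ∷ʳ true))) (Σ (λ t → F ((true ∷ t) ∷ʳ false)))
                  (Σ (λ t → F ((false ∷ t) ∷ʳ true))) (Σ (λ t → F ((false ∷ t) ∷ʳ false)))
  ■ sym (cong₂ _+_ (allVecs-cons-split L (λ t → F (t ∷ʳ true))) (allVecs-cons-split L (λ t → F (t ∷ʳ false))))
  where
  Σ : (Vec Bool L → ℕ) → ℕ
  Σ = sumList (allVecs L)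

prefix : (K : ℕ) → (ℕ → Bool) → Vec Bool K
prefix zero D = []
prefix (suc K) D = D 0 ∷ prefix K (λ x → D (suc x))

at-prefix : ∀ K D x → x < K → at (prefix K D) x ≡ D x
at-prefix (suc K) D zero _ = refl
at-prefix (suc K) D (suc x) (s≤s x<K) = at-prefix K (λ y → D (suc y)) x x<K

prefix-cong : ∀ K {D E : ℕ → Bool} → (∀ x → D x ≡ E x) → prefix K D ≡ prefix K E
prefix-cong zero h = refl
prefix-cong (suc K) h = cong₂ _∷_ (h 0) (prefix-cong K (λ x → h (suc x)))

-- Only the actual prefix of D satisfies the test, so the sum over all vectors collapses.
sumList-unique-prefix : ∀ K D (g : Vec Bool K → ℕ) →
  sumList (allVecs K) (λ u → if allTo K (λ i → if D i then at u i else not (at u i)) then g u else 0)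
  ≡ g (prefix K D)
sumList-unique-prefix zero D g = +-identityʳ (g [])
sumList-unique-prefix (suc K) D g =
  allVecs-cons-split K _
  ■ cong₂ _+_ (sumList-cong (allVecs K) (λ t → cong (λ c → if c then g (true ∷ t) else 0) (allTo-front K _)))
              (sumList-cong (allVecs K) (λ t → cong (λ c → if c then g (false ∷ t) else 0) (allTo-front K _)))
  ■ by-first-bit (D 0) refl
  where
  D′ : ℕ → Bool
  D′ x = D (suc x)
  test : Vec Bool K → Bool
  test = λ t → allTo K (λ i → if D′ i then at t i else not (at t i))
  by-first-bit : ∀ b → D 0 ≡ b →
    sumList (allVecs K) (λ t → if (if b then true else false) ∧ test t then g (true ∷ t) else 0)
    + sumList (allVecs K) (λ t → if (if b then false else true) ∧ test t then g (false ∷ t) else 0)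
    ≡ g (prefix (suc K) D)
  by-first-bit true e rewrite e =
    cong₂ _+_ (sumList-unique-prefix K D′ (λ t → g (true ∷ t))) (sumList-zero (allVecs K) (λ _ → refl))
    ■ +-identityʳ _
  by-first-bit false e rewrite e =
    cong (_+ sumList (allVecs K) (λ t → if test t then g (false ∷ t) else 0)) (sumList-zero (allVecs K) {λ _ → 0} (λ _ → refl))
    ■ sumList-unique-prefix K D′ (λ t → g (false ∷ t))

memV-beyond : ∀ {L} (s : Vec Bool L) x → L ≤ x → memV s x ≡ true
memV-beyond [] x _ = refl
memV-beyond (b ∷ s) (suc x) (s≤s L≤x) = memV-beyond s x L≤x

memV-snoc-true : ∀ {L} (t : Vec Bool L) x → memV (t ∷ʳ true) x ≡ memV t x
memV-snoc-true [] zero = refl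
memV-snoc-true [] (suc x) = refl
memV-snoc-true (b ∷ t) zero = refl
memV-snoc-true (b ∷ t) (suc x) = memV-snoc-true t x

memV-snoc-false : ∀ {L} (t : Vec Bool L) → memV (t ∷ʳ false) L ≡ false
memV-snoc-false [] = refl
memV-snoc-false (b ∷ t) = memV-snoc-false t

⊕-cong : ∀ {F F′ G G′} → F ≈S F′ → G ≈S G′ → (F ⊕ G) ≈S (F′ ⊕ G′)
⊕-cong p q d i j = cong₂ _+_ (p d i j) (q d i j)

≡⇒≈S : ∀ {F G} → F ≡ G → F ≈S G
≡⇒≈S refl d i j = refl

≈S-trans : ∀ {F G H} → F ≈S G → G ≈S H → F ≈S H
≈S-trans p q d i j = p d i j ■ q d i j

≈S-sym : ∀ {F G} → F ≈S G → G ≈S F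
≈S-sym p d i j = sym (p d i j)

mono-⊕ : ∀ a z b F G → mono a z b (F ⊕ G) ≈S (mono a z b F ⊕ mono a z b G)
mono-⊕ a z b F G d i j with (a ≤ᵇ d) ∧ (b ≤ᵇ j)
... | true = refl
... | false = refl

≤ᵇ-+ : ∀ a₁ a₂ d → ((a₁ ≤ᵇ d) ∧ (a₂ ≤ᵇ d ∸ a₁)) ≡ (a₁ + a₂ ≤ᵇ d)
≤ᵇ-+ zero a₂ d = refl
≤ᵇ-+ (suc a) a₂ zero = refl
≤ᵇ-+ (suc a) a₂ (suc d) rewrite ≤ᵇ-suc a d | ≤ᵇ-suc (a + a₂) d = ≤ᵇ-+ a a₂ d

mono-mono : ∀ a₁ z₁ b₁ a₂ z₂ b₂ F →
            mono a₁ z₁ b₁ (mono a₂ z₂ b₂ F) ≈S mono (a₁ + a₂) (z₁ ℤ.+ z₂) (b₁ + b₂) F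
mono-mono a₁ z₁ b₁ a₂ z₂ b₂ F d i j =
  nested-if (a₁ ≤ᵇ d) (b₁ ≤ᵇ j) (a₂ ≤ᵇ d ∸ a₁) (b₂ ≤ᵇ j ∸ b₁) _
  ■ cong₂ (λ c₁ c₂ → if c₁ ∧ c₂ then F (d ∸ a₁ ∸ a₂) ((i ℤ.- z₁) ℤ.- z₂) (j ∸ b₁ ∸ b₂) else 0)
          (≤ᵇ-+ a₁ a₂ d) (≤ᵇ-+ b₁ b₂ j)
  ■ cong (λ X → if (a₁ + a₂ ≤ᵇ d) ∧ (b₁ + b₂ ≤ᵇ j) then X else 0)
         (cong₂ (λ x y → F x y (j ∸ b₁ ∸ b₂)) (∸-+-assoc d a₁ a₂) (sub-sub i z₁ z₂)
          ■ cong (F (d ∸ (a₁ + a₂)) (i ℤ.- (z₁ ℤ.+ z₂))) (∸-+-assoc j b₁ b₂))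
  where
  nested-if : ∀ A₁ A₂ B₁ B₂ (X : ℕ) →
    (if A₁ ∧ A₂ then (if B₁ ∧ B₂ then X else 0) else 0) ≡ (if (A₁ ∧ B₁) ∧ (A₂ ∧ B₂) then X else 0)
  nested-if true true B₁ B₂ X = refl
  nested-if true false B₁ B₂ X = cong (λ c → if c then X else 0) (sym (∧-zeroʳ B₁))
  nested-if false A₂ B₁ B₂ X = refl
  sub-sub : ∀ i z₁ z₂ → (i ℤ.- z₁) ℤ.- z₂ ≡ i ℤ.- (z₁ ℤ.+ z₂)
  sub-sub i z₁ z₂ = ℤP.+-assoc i (- z₁) (- z₂) ■ cong (ℤ._+_ i) (sym (ℤP.neg-distrib-+ z₁ z₂))

isX : Sym → Bool
isX ✗ = true
isX o = false
isX ● = false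

isX-sym : ∀ a b → isX (symb a b) ≡ (a ∧ not b)
isX-sym false b = refl
isX-sym true true = refl
isX-sym true false = refl

labs : (L : ℕ) → (ℕ → Sym) → Vec Sym L
labs zero f = []
labs (suc L) f = f 0 ∷ labs L (λ x → f (suc x))

tabulate-labs : ∀ L (f : ℕ → Sym) → tabulate {n = L} (λ i → f (toℕ i)) ≡ labs L f
tabulate-labs zero f = refl
tabulate-labs (suc L) f = cong (f 0 ∷_) (tabulate-labs L (λ x → f (suc x)))

labs-cong : ∀ L {f g : ℕ → Sym} → (∀ x → x < L → f x ≡ g x) → labs L f ≡ labs L g
labs-cong zero h = refl
labs-cong (suc L) h = cong₂ _∷_ (h 0 (s≤s z≤n)) (labs-cong L (λ x x<L → h (suc x) (s≤s x<L)))

labs-snoc : ∀ L (f : ℕ → Sym) → labs (suc L) f ≡ labs L f ∷ʳ f L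
labs-snoc zero f = refl
labs-snoc (suc L) f = cong (f 0 ∷_) (labs-snoc L (λ x → f (suc x)))

crosses-labs : ∀ L (f : ℕ → Sym) → crosses (labs L f) ≡ countTo L (λ i → isX (f i))
crosses-labs zero f = refl
crosses-labs (suc L) f =
  crosses-cons (f 0) _ ■ cong (_+_ (ind (isX (f 0)))) (crosses-labs L (λ x → f (suc x))) ■ sym (sumTo-front L _)
  where
  crosses-cons : ∀ {L} x (v : Vec Sym L) → crosses (x ∷ v) ≡ ind (isX x) + crosses v
  crosses-cons o v = refl
  crosses-cons ● v = refl
  crosses-cons ✗ v = refl

==S-sound : ∀ x y → (x ==S y) ≡ true → x ≡ y
==S-sound o o _ = refl
==S-sound ● ● _ = refl
==S-sound ✗ ✗ _ = refl
==S-sound o ● ()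
==S-sound o ✗ ()
==S-sound ● o ()
==S-sound ● ✗ ()
==S-sound ✗ o ()
==S-sound ✗ ● ()

eqV-sound : ∀ {L} (a b : Vec Sym L) → eqV a b ≡ true → a ≡ b
eqV-sound [] [] _ = refl
eqV-sound (x ∷ a) (y ∷ b) e = cong₂ _∷_ (==S-sound x y (∧-≡-trueˡ e)) (eqV-sound a b (∧-≡-trueʳ {x ==S y} e))

eqV-snoc : ∀ {L} (a b : Vec Sym L) x y → eqV (a ∷ʳ x) (b ∷ʳ y) ≡ (eqV a b ∧ (x ==S y))
eqV-snoc [] [] x y = ∧-identityʳ (x ==S y)
eqV-snoc (a ∷ as) (b ∷ bs) x y rewrite eqV-snoc as bs x y = sym (∧-assoc (a ==S b) _ _)

module Recursion (m n : ℕ) where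

  M N K : ℕ
  M = suc m
  N = suc n
  K = N + M

  Mem : Set
  Mem = ℕ → Bool

  _≐_ : Mem → Mem → Set
  D ≐ E = ∀ x → D x ≡ E x

  shift : Mem → Mem
  shift D x = D (suc x)

  inI : Mem → ℕ → Bool
  inI = inIMN M N

  areaΔ : Mem → ℕ → ℕ
  areaΔ = area' M N

  lamΔ : Mem → ℕ → ℕ
  lamΔ = lam M N

  lamkΔ : Mem → ℕ → ℕ → ℕ
  lamkΔ = lamk M N

  codinvΔ : Mem → ℕ → ℤ
  codinvΔ = codinv' M N

  dcogensΔ : Mem → ℕ → List ℕ
  dcogensΔ = dcogens M N

  contribΔ : Mem → ℕ → Ser
  contribΔ = contrib M N

  isGenΔ : Mem → ℕ → Bool
  isGenΔ = isGen M N

  coHighΔ : Mem → ℕ → Bool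
  coHighΔ = coHigh M N

  window : Mem → ℕ → ℕ → Bool
  window D a x = (a ≤ᵇ x) ∧ (x <ᵇ a + M) ∧ coHighΔ D x

  genWeight : Mem → ℕ → ℕ → ℕ
  genWeight D B a = if isGenΔ D a then countTo B (window D a) else 0

  weightSum : Mem → ℕ → ℕ
  weightSum D B = sumTo (B + N) (genWeight D B)

  tri : ℕ → ℕ
  tri l = (l * (l ∸ 1)) / 2

  tri-suc : ∀ c → + tri (suc c) ≡ + tri c ℤ.+ + c
  tri-suc c = cong +_ (cong (_/ 2) (expand c) ■ +-distrib-/-∣ʳ (c * (c ∸ 1)) (divides c refl)
                       ■ cong (_+_ (tri c)) (m*n/n≡m c 2))
              ■ ℤP.pos-+ (tri c) c
    where
    open import Data.Nat.Tactic.RingSolver using (solve-∀)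
    expand : ∀ c → suc c * c ≡ c * (c ∸ 1) + c * 2
    expand zero = refl
    expand (suc k) = expand′ k
      where
      expand′ : ∀ k → suc (suc k) * suc k ≡ suc k * k + suc k * 2
      expand′ = solve-∀

  cogenFactor : Mem → ℕ → Ser
  cogenFactor D B = foldr (λ k F → F ⊕ mono 0 (- (+ lamkΔ D B k)) 1 F) oneS (dcogensΔ D B)

  innerGens : Mem → ℕ
  innerGens D = countTo m (λ i → D (N + suc i) ∧ not (D (suc i)))

  isGen-N+ : ∀ D i → isGenΔ D (N + i) ≡ (D (N + i) ∧ not (D i))
  isGen-N+ D i rewrite ≥⇒<ᵇ≡false {N + i} {N} (m≤m+n N i) | m+n∸m≡n N i = refl

  isGen-shift : ∀ D a → N ≤ a → isGenΔ D (suc a) ≡ isGenΔ (shift D) a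
  isGen-shift D a N≤a rewrite ≥⇒<ᵇ≡false {suc a} {N} (m≤n⇒m≤1+n N≤a) | ≥⇒<ᵇ≡false {a} {N} N≤a
                            | +-∸-assoc 1 N≤a = refl

  isGen-beyond : ∀ D a → N ≤ a → D (a ∸ N) ≡ true → isGenΔ D a ≡ false
  isGen-beyond D a N≤a e rewrite ≥⇒<ᵇ≡false {a} {N} N≤a | e = ∧-zeroʳ (D a)

  contrib-parts-cong : ∀ D B E C → areaΔ D B ≡ areaΔ E C → codinvΔ D B ≡ codinvΔ E C →
    dcogensΔ D B ≡ dcogensΔ E C → (∀ k → lamkΔ D B k ≡ lamkΔ E C k) → contribΔ D B ≡ contribΔ E C
  contrib-parts-cong D B E C ea ec ed el =
    cong₂ (λ a c → mono a (- c) 0 (cogenFactor D B)) ea ec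
    ■ cong (mono (areaΔ E C) (- codinvΔ E C) 0)
           (cong (foldr (λ k F → F ⊕ mono 0 (- (+ lamkΔ D B k)) 1 F) oneS) ed
            ■ foldr-cong (dcogensΔ E C))
    where
    foldr-cong : ∀ ks → foldr (λ k F → F ⊕ mono 0 (- (+ lamkΔ D B k)) 1 F) oneS ks
                        ≡ foldr (λ k F → F ⊕ mono 0 (- (+ lamkΔ E C k)) 1 F) oneS ks
    foldr-cong [] = refl
    foldr-cong (k ∷ ks) rewrite foldr-cong ks | el k = refl

  contrib-cong : ∀ {D E} B → D ≐ E → contribΔ D B ≡ contribΔ E B
  contrib-cong {D} {E} B h =
    contrib-parts-cong D B E B
      (sumTo-cong B (λ x _ → cong ind (coHigh-cong x)))
      (cong₂ (λ s l → + s ℤ.- + tri l)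
        (sumTo-cong (B + N) (λ a _ → cong₂ (λ g c → if g then c else 0) (isGen-cong a)
          (sumTo-cong B (λ x _ → cong ind (cong ((a ≤ᵇ x) ∧_) (cong ((x <ᵇ a + M) ∧_) (coHigh-cong x)))))))
        (sumTo-cong (B + N) (λ a _ → cong ind (cong (_∧ _) (isGen-cong a)))))
      (filterTo-cong B (λ k _ → cong₂ (λ u w → not u ∧ w) (h k) (cong₂ _∧_ (h (k + N)) (h (k + M)))))
      (λ k → sumTo-cong (B + N) (λ a _ → cong ind (cong (_∧ _) (isGen-cong a))))
    where
    isGen-cong : ∀ a → isGenΔ D a ≡ isGenΔ E a
    isGen-cong a rewrite h a | h (a ∸ N) = refl
    coHigh-cong : ∀ x → coHighΔ D x ≡ coHighΔ E x
    coHigh-cong x rewrite h x = refl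

  inI-cong : ∀ {D E} B → D ≐ E → inI D B ≡ inI E B
  inI-cong B h = allTo-cong B (λ x _ → cong₂ (λ u w → not u ∨ w) (h x) (cong₂ _∧_ (h (x + N)) (h (x + M))))

  FullFrom : Mem → ℕ → Set
  FullFrom D L = ∀ x → L ≤ x → D x ≡ true

  module Extend (D : Mem) (L : ℕ) (full : FullFrom D L) where

    isGen-L+N : isGenΔ D (L + N) ≡ false
    isGen-L+N = isGen-beyond D (L + N) (m≤n+m N L) (cong D (m+n∸n≡m L N) ■ full L ≤-refl)

    coHigh-L : coHighΔ D L ≡ false
    coHigh-L rewrite full L ≤-refl = ∧-zeroʳ _

    contrib-extend : contribΔ D (suc L) ≡ contribΔ D L
    contrib-extend = contrib-parts-cong D (suc L) D L
      (countTo-suc-false L coHigh-L)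
      (cong₂ (λ s l → + s ℤ.- + tri l) weightSum-extend lam-extend)
      (filterTo-suc-false L (cong (λ u → not u ∧ (D (L + N) ∧ D (L + M))) (full L ≤-refl)))
      (λ k → countTo-suc-false (L + N) (cong (_∧ _) isGen-L+N))
      where
      lam-extend : lamΔ D (suc L) ≡ lamΔ D L
      lam-extend = countTo-suc-false (L + N) (cong (_∧ _) isGen-L+N)
      weightSum-extend : weightSum D (suc L) ≡ weightSum D L
      weightSum-extend =
        cong (_+ genWeight D (suc L) (L + N)) (sumTo-cong (L + N) (λ a _ →
          cong (λ c → if isGenΔ D a then c else 0)
               (countTo-suc-false L (cong (λ c → (a ≤ᵇ L) ∧ (L <ᵇ a + M) ∧ c) coHigh-L
                                     ■ cong ((a ≤ᵇ L) ∧_) (∧-zeroʳ _) ■ ∧-zeroʳ _))))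
        ■ cong (λ g → weightSum D L + (if g then countTo (suc L) (window D (L + N)) else 0)) isGen-L+N
        ■ +-identityʳ _

    inI-extend : inI D (suc L) ≡ inI D L
    inI-extend = allTo-suc-true L
      (cong (λ u → not u ∨ (D (L + N) ∧ D (L + M))) (full L ≤-refl)
       ■ cong₂ _∧_ (full (L + N) (m≤m+n L N)) (full (L + M) (m≤m+n L M)))

  coHigh-gap : ∀ D x → D x ≡ false → K ≤ x → coHighΔ D x ≡ true
  coHigh-gap D x Dx≡false K≤x rewrite Dx≡false | ≤⇒≤ᵇ≡true K≤x = refl

  -- A gap x ≥ N+M forces the gaps x - N, x - 2N, … ≥ N+M.
  gap-area : ∀ D B → inI D B ≡ true → ∀ e x → D x ≡ false → K + e * N ≤ x → x < B →
             e < areaΔ D (suc x)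
  gap-area D B inΔ zero x Dx≡false K≤x _ rewrite coHigh-gap D x Dx≡false (≤-trans (m≤m+n K 0) K≤x) =
    m≤n+m 1 _
  gap-area D B inΔ (suc e) x Dx≡false bound≤x x<B =
    subst (suc e <_) (sym (cong (_+_ (areaΔ D x)) (cong ind (coHigh-gap D x Dx≡false K≤x))))
          (subst (_≤ areaΔ D x + 1) (+-comm (suc e) 1)
                 (+-monoˡ-≤ 1 (≤-trans ih (sumTo-mono (suc y) x _ y<x))))
    where
    K≤x : K ≤ x
    K≤x = ≤-trans (m≤m+n K (suc e * N)) bound≤x
    y : ℕ
    y = x ∸ N
    y+N≡x : y + N ≡ x
    y+N≡x = m∸n+n≡m (≤-trans (m≤m+n N M) K≤x)
    y<x : y < x
    y<x = subst (y <_) y+N≡x (m<m+n y {N} (s≤s z≤n))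
    bound≤y : K + e * N ≤ y
    bound≤y = +-cancelʳ-≤ N (K + e * N) y
      (subst₂ _≤_ (cong (_+_ K) (+-comm N (e * N)) ■ sym (+-assoc K (e * N) N)) (sym y+N≡x) bound≤x)
    Dy≡false : D y ≡ false
    Dy≡false with D y in eq
    ... | false = refl
    ... | true with subst (λ u → not u ∨ (D (y + N) ∧ D (y + M)) ≡ true) eq
                        (allTo-sound B inΔ y (<-trans y<x x<B))
    ...   | closedAt-y rewrite y+N≡x | Dx≡false with closedAt-y
    ...     | ()
    ih : e < areaΔ D (suc y)
    ih = gap-area D B inΔ e y Dy≡false bound≤y (<-trans y<x x<B)

  contrib-vanishes : ∀ D B e i j → e < areaΔ D B → contribΔ D B e i j ≡ 0
  contrib-vanishes D B e i j e<area rewrite >⇒≤ᵇ≡false {areaΔ D B} {e} e<area = refl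

  labelled : Vec Sym M → Vec Sym N → Mem → Bool
  labelled v w D = eqV (vOf M N (prefix (N + M) D)) v ∧ eqV (wOf M N (prefix (N + M) D)) w

  labelled-cong : ∀ v w {D E} → D ≐ E → labelled v w D ≡ labelled v w E
  labelled-cong v w h = cong (λ u → eqV (vOf M N u) v ∧ eqV (wOf M N u) w) (prefix-cong (N + M) h)

  summand : Vec Sym M → Vec Sym N → (Ser → Ser) → (L : ℕ) → ℕ → ℤ → ℕ → Vec Bool L → ℕ
  summand v w F L d i j s = if inI (memV s) L ∧ labelled v w (memV s) then F (contribΔ (memV s) L) d i j else 0

  QΔ : ℕ → Vec Sym M → Vec Sym N → ℕ → ℤ → ℕ → ℕ
  QΔ L v w d i j = sumList (allVecs L) (summand v w id L d i j)

  QVW-as-QΔ : ∀ v w d i j → QVW M N v w d i j ≡ QΔ (bound M N d) v w d i j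
  QVW-as-QΔ v w d i j =
    sumListS-apply (allVecs (N + M)) _ d i j
    ■ sumList-cong (allVecs (N + M)) (λ u →
        if-apply (lab u) (Qhat M N u)
        ■ cong (λ z → if lab u then z else 0)
               (sumListS-apply (allVecs B) _ d i j
                ■ sumList-cong (allVecs B) (λ s → if-apply (inI (memV s) B ∧ hasPrefix M N (memV s) u) _))
        ■ sym (sumList-if (allVecs B) (lab u) _))
    ■ sumList-swap (allVecs (N + M)) (allVecs B) _
    ■ sumList-cong (allVecs B) (λ s →
        sumList-cong (allVecs (N + M)) (λ u → reorder (lab u) (hasPrefix M N (memV s) u) (inI (memV s) B) _)
        ■ sumList-unique-prefix (N + M) (memV s) (λ u → if inI (memV s) B ∧ lab u then contribΔ (memV s) B d i j else 0))
    where
    B : ℕ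
    B = bound M N d
    lab : Vec Bool (N + M) → Bool
    lab u = eqV (vOf M N u) v ∧ eqV (wOf M N u) w
    if-apply : ∀ (b : Bool) (F : Ser) → (if b then F else zeroS) d i j ≡ (if b then F d i j else 0)
    if-apply true F = refl
    if-apply false F = refl
    reorder : ∀ (c h I : Bool) (X : ℕ) →
      (if c then (if I ∧ h then X else 0) else 0) ≡ (if h then (if I ∧ c then X else 0) else 0)
    reorder true true I X = refl
    reorder true false I X = cong (λ z → if z then X else 0) (∧-zeroʳ I)
    reorder false true I X = cong (λ z → if z then X else 0) (sym (∧-zeroʳ I))
    reorder false false I X = refl

  QΔ-suc : ∀ v w e i j L → bound M N e ≤ L → QΔ (suc L) v w e i j ≡ QΔ L v w e i j
  QΔ-suc v w e i j L bound≤L =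
    allVecs-snoc-split L _
    ■ cong₂ _+_ (sumList-cong (allVecs L) full-last) (sumList-zero (allVecs L) gap-last)
    ■ +-identityʳ _
    where
    full-last : ∀ t → summand v w id (suc L) e i j (t ∷ʳ true) ≡ summand v w id L e i j t
    full-last t =
      if-cong (cong₂ _∧_ (inI-cong (suc L) (memV-snoc-true t) ■ inI-extend)
                         (labelled-cong v w (memV-snoc-true t)))
              (λ _ → cong (λ F → F e i j) (contrib-cong (suc L) (memV-snoc-true t) ■ contrib-extend))
      where open Extend (memV t) L (memV-beyond t)
    gap-last : ∀ t → summand v w id (suc L) e i j (t ∷ʳ false) ≡ 0
    gap-last t with inI (memV (t ∷ʳ false)) (suc L) in inΔ
    ... | false = refl
    ... | true rewrite contrib-vanishes (memV (t ∷ʳ false)) (suc L) e i j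
                         (gap-area (memV (t ∷ʳ false)) (suc L) inΔ e L (memV-snoc-false t) bound≤L ≤-refl)
                 with labelled v w (memV (t ∷ʳ false))
    ...   | true = refl
    ...   | false = refl

  QΔ-stable : ∀ v w e i j L → bound M N e ≤ L → QΔ (bound M N e) v w e i j ≡ QΔ L v w e i j
  QΔ-stable v w e i j L bound≤L =
    sym (go (L ∸ bound M N e)) ■ cong (λ z → QΔ z v w e i j) (m∸n+n≡m bound≤L)
    where
    go : ∀ k → QΔ (k + bound M N e) v w e i j ≡ QΔ (bound M N e) v w e i j
    go zero = refl
    go (suc k) = QΔ-suc v w e i j (k + bound M N e) (m≤n+m _ k) ■ go k

  mono-QVW : ∀ a z b v w d i j → mono a z b (QVW M N v w) d i j
             ≡ sumList (allVecs (bound M N d)) (summand v w (mono a z b) (bound M N d) d i j)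
  mono-QVW a z b v w d i j =
    cong (λ X → if (a ≤ᵇ d) ∧ (b ≤ᵇ j) then X else 0)
         (QVW-as-QΔ v w (d ∸ a) (i ℤ.- z) (j ∸ b)
          ■ QΔ-stable v w (d ∸ a) (i ℤ.- z) (j ∸ b) (bound M N d)
                      (+-monoʳ-≤ K (*-monoˡ-≤ N (m∸n≤m d a))))
    ■ sumList-guard (allVecs (bound M N d)) (λ t → inI (memV t) (bound M N d) ∧ labelled v w (memV t))
                    ((a ≤ᵇ d) ∧ (b ≤ᵇ j)) _

  inI-front : ∀ D B → inI D (suc B) ≡ ((not (D 0) ∨ (D N ∧ D M)) ∧ inI (shift D) B)
  inI-front D B = allTo-front B _

  lam-range : ∀ D B → M ≤ B → lamΔ D B ≡ countTo M (λ i → isGenΔ D (N + i))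
  lam-range D B M≤B =
    sumTo-extend (N + M) (B + N) (subst (N + M ≤_) (+-comm N B) (+-monoʳ-≤ N M≤B)) beyond
    ■ sumTo-split N M h
    ■ cong₂ _+_ (sumTo-zero N (λ a a<N → cong ind (cong (λ z → isGenΔ D a ∧ (z ∧ (a <ᵇ N + M))) (>⇒≤ᵇ≡false a<N)
                                                      ■ ∧-zeroʳ _)))
                (sumTo-cong M (λ i i<M → cong ind (cong (isGenΔ D (N + i) ∧_)
                                            (cong₂ _∧_ (≤⇒≤ᵇ≡true (m≤m+n N i)) (<⇒<ᵇ≡true (+-monoʳ-< N i<M)))
                                          ■ ∧-identityʳ _)))
    where
    h : ℕ → ℕ
    h a = ind (isGenΔ D a ∧ ((N ≤ᵇ a) ∧ (a <ᵇ N + M)))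
    beyond : ∀ x → N + M ≤ x → h x ≡ 0
    beyond x le rewrite ≥⇒<ᵇ≡false {x} {N + M} le | ∧-zeroʳ (N ≤ᵇ x) | ∧-zeroʳ (isGenΔ D x) = refl

  isGen-shift-∧ : ∀ D a (c : Bool) → (c ≡ true → N ≤ a) → (isGenΔ D (suc a) ∧ c) ≡ (isGenΔ (shift D) a ∧ c)
  isGen-shift-∧ D a true h rewrite isGen-shift D a (h refl) = refl
  isGen-shift-∧ D a false h rewrite ∧-zeroʳ (isGenΔ D (suc a)) | ∧-zeroʳ (isGenΔ (shift D) a) = refl

  lamk-shift : ∀ D B k → lamkΔ D (suc B) (suc k) ≡ lamkΔ (shift D) B k
  lamk-shift D B k =
    sumTo-front (B + N) counted
    ■ cong (_+ sumTo (B + N) (λ a → counted (suc a))) (cong ind (∧-zeroʳ (isGenΔ D 0)))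
    ■ sumTo-cong (B + N) (λ a _ → cong ind
        (cong (isGenΔ D (suc a) ∧_) (cong₂ _∧_ (≤ᵇ-suc (suc (k + N)) a) (≤ᵇ-suc a (k + N + M)))
         ■ isGen-shift-∧ D a _ (λ e → ≤-trans (m≤n+m N k) (≤-trans (n≤1+n _) (≤ᵇ≡true⇒≤ _ a (∧-≡-trueˡ e))))))
    where
    counted : ℕ → ℕ
    counted a = ind (isGenΔ D a ∧ ((suc (suc k + N) ≤ᵇ a) ∧ (a ≤ᵇ suc k + N + M)))

  lamk-zero-shift : ∀ D B → lamkΔ D (suc B) 0 ≡ lamΔ (shift D) B
  lamk-zero-shift D B =
    sumTo-front (B + N) counted
    ■ cong (_+ sumTo (B + N) (λ a → counted (suc a))) (cong ind (∧-zeroʳ (isGenΔ D 0)))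
    ■ sumTo-cong (B + N) (λ a _ → cong ind
        (cong (isGenΔ D (suc a) ∧_) (cong₂ _∧_ (≤ᵇ-suc N a) (≤ᵇ-suc a (n + M) ■ ≤ᵇ≡<ᵇ-suc a (n + M)))
         ■ isGen-shift-∧ D a _ (λ e → ≤ᵇ≡true⇒≤ N a (∧-≡-trueˡ e))))
    where
    counted : ℕ → ℕ
    counted a = ind (isGenΔ D a ∧ ((suc N ≤ᵇ a) ∧ (a ≤ᵇ N + M)))

  cogenFactor-shift-foldr : ∀ D B ks →
    foldr (λ k F → F ⊕ mono 0 (- (+ lamkΔ D (suc B) k)) 1 F) oneS (map suc ks)
    ≡ foldr (λ k F → F ⊕ mono 0 (- (+ lamkΔ (shift D) B k)) 1 F) oneS ks
  cogenFactor-shift-foldr D B [] = refl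
  cogenFactor-shift-foldr D B (k ∷ ks) rewrite cogenFactor-shift-foldr D B ks | lamk-shift D B k = refl

  module ShiftAt (D : Mem) (B : ℕ) (K≤B : K ≤ B) {b p q r : Bool}
                 (e0 : D 0 ≡ b) (eN : D N ≡ p) (eM : D M ≡ q) (eK : D K ≡ r) where

    D′ : Mem
    D′ = shift D

    c A′ S′ L′ : ℕ
    c = innerGens D
    A′ = areaΔ D′ B
    S′ = weightSum D′ B
    L′ = lamΔ D′ B

    P′ : Ser
    P′ = cogenFactor D′ B

    M≤B : M ≤ B
    M≤B = ≤-trans (m≤n+m M N) K≤B

    lam-head : lamΔ D (suc B) ≡ ind (p ∧ not b) + c
    lam-head =
      lam-range D (suc B) (m≤n⇒m≤1+n M≤B)
      ■ sumTo-front m _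
      ■ cong₂ (λ g rest → ind g + rest)
              (isGen-N+ D 0 ■ cong₂ (λ u v → u ∧ not v) (cong D (+-identityʳ N) ■ eN) e0)
              (sumTo-cong m (λ i _ → cong ind (isGen-N+ D (suc i))))

    lam-tail : L′ ≡ c + ind (r ∧ not q)
    lam-tail =
      lam-range D′ B M≤B
      ■ cong₂ _+_ (sumTo-cong m (λ i _ → cong ind (isGen-N+ D′ i ■ cong (λ a → D a ∧ not (D (suc i))) (sym (+-suc N i)))))
                  (cong ind (isGen-N+ D′ m ■ cong₂ (λ u v → u ∧ not v) (cong D (sym (+-suc N m)) ■ eK) eM))

    area-shift : areaΔ D (suc B) ≡ A′ + (if r then 0 else 1)
    area-shift =
      sym (+-identityʳ _)
      ■ cong (_+ 0) (sumTo-front B _)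
      ■ cong (_+_ (sumTo B (λ x → ind (coHighΔ D (suc x))))) (sym (cong ind (cong (_∧ not (D′ (n + M))) n+M≮n+M)))
      ■ sumTo-exchange-at B (n + M) K≤B (λ x _ x≢ → cong ind (cong (_∧ not (D (suc x))) (<ᵇ-suc-≢ (n + M) x x≢)))
      ■ cong (_+_ A′) (last (D K) ■ cong (λ z → if z then 0 else 1) eK)
      where
      n+M≮n+M : (n + M <ᵇ n + M) ≡ false
      n+M≮n+M = ≥⇒<ᵇ≡false {n + M} {n + M} ≤-refl
      last : ∀ a → ind ((K ≤ᵇ suc (n + M)) ∧ not a) ≡ (if a then 0 else 1)
      last a rewrite <⇒<ᵇ≡true {n + M} {suc (n + M)} ≤-refl with a
      ... | true = refl
      ... | false = refl

    -- Windows of Δ′ are those of Δ moved down by one, except that the point K of Δ drops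
    -- below N+M; it was counted once for each N-generator of Δ′ in [N, N+M).
    weightSum-shift : weightSum D (suc B) ≡ S′ + (if r then 0 else L′)
    weightSum-shift =
      sumTo-front (B + N) (genWeight D (suc B))
      ■ cong (_+ sumTo (B + N) (λ a → genWeight D (suc B) (suc a))) at-zero
      ■ sumTo-cong (B + N) (λ a _ → pointwise a)
      ■ sumTo-+ (B + N) (genWeight D′ B) _
      ■ cong (_+_ S′) (sumTo-if (B + N) (D K) _ ■ cong (λ z → if z then 0 else L′) eK)
      where
      below-K : ∀ c′ → c′ ≤ K → ∀ x b′ → ((x <ᵇ c′) ∧ ((K ≤ᵇ x) ∧ b′)) ≡ false
      below-K c′ c′≤K x b′ with x <? c′
      ... | yes x<c′ rewrite <⇒<ᵇ≡true x<c′ | >⇒≤ᵇ≡false {K} {x} (<-≤-trans x<c′ c′≤K) = refl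
      ... | no x≮c′ rewrite ≥⇒<ᵇ≡false {x} {c′} (≮⇒≥ x≮c′) = refl
      at-zero : genWeight D (suc B) 0 ≡ 0
      at-zero rewrite sumTo-zero (suc B) {λ x → ind (window D 0 x)} (λ x _ → cong ind (below-K M (m≤n+m M N) x _))
        with isGenΔ D 0
      ... | true = refl
      ... | false = refl
      window-shift : ∀ a → countTo (suc B) (window D (suc a))
        ≡ countTo B (window D′ a) + ind ((a <ᵇ K) ∧ ((n + M <ᵇ a + M) ∧ not (D K)))
      window-shift a =
        sumTo-front B _
        ■ sym (+-identityʳ _)
        ■ cong (_+_ (sumTo B (λ x → ind (window D (suc a) (suc x))))) (sym at-n+M)
        ■ sumTo-exchange-at B (n + M) K≤B (λ x _ x≢ → cong ind (cong₂ _∧_ (≤ᵇ-suc a x)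
            (cong (λ z → (x <ᵇ a + M) ∧ (z ∧ not (D (suc x)))) (<ᵇ-suc-≢ (n + M) x x≢))))
        ■ cong (_+_ (countTo B (window D′ a))) (cong ind (cong₂ _∧_ (≤ᵇ-suc a (n + M) ■ ≤ᵇ≡<ᵇ-suc a (n + M))
            (cong (λ z → (n + M <ᵇ a + M) ∧ (z ∧ not (D K))) (<⇒<ᵇ≡true {n + M} {suc (n + M)} ≤-refl))))
        where
        at-n+M : ind (window D′ a (n + M)) ≡ 0
        at-n+M rewrite ≥⇒<ᵇ≡false {n + M} {n + M} ≤-refl | ∧-zeroʳ (n + M <ᵇ a + M) | ∧-zeroʳ (a ≤ᵇ n + M) = refl
      tidy-gen : ∀ g dk ak C → (if g then C + ind (ak ∧ (true ∧ not dk)) else 0)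
                 ≡ (if g then C else 0) + (if dk then 0 else ind (g ∧ (true ∧ ak)))
      tidy-gen true true ak C rewrite ∧-zeroʳ ak = refl
      tidy-gen true false true C = refl
      tidy-gen true false false C = refl
      tidy-gen false true ak C = refl
      tidy-gen false false ak C = refl
      tidy-low : ∀ g g′ dk ak x → (if g then 0 + ind (ak ∧ (false ∧ x)) else 0)
                 ≡ (if g′ then 0 else 0) + (if dk then 0 else ind (g′ ∧ (false ∧ x)))
      tidy-low g g′ dk ak x rewrite ∧-zeroʳ ak | ∧-zeroʳ g′ with g | g′ | dk
      ... | true  | true  | true  = refl
      ... | true  | true  | false = refl
      ... | true  | false | true  = refl
      ... | true  | false | false = refl
      ... | false | true  | true  = refl
      ... | false | true  | false = refl
      ... | false | false | true  = refl
      ... | false | false | false = refl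
      pointwise : ∀ a → genWeight D (suc B) (suc a)
                  ≡ genWeight D′ B a + (if D K then 0 else ind (isGenΔ D′ a ∧ ((N ≤ᵇ a) ∧ (a <ᵇ N + M))))
      pointwise a with N ≤? a
      ... | yes N≤a rewrite window-shift a | isGen-shift D a N≤a | <⇒<ᵇ≡true {n + M} {a + M} (+-monoˡ-< M {n} {a} N≤a)
                          | ≤⇒≤ᵇ≡true N≤a =
            tidy-gen (isGenΔ D′ a) (D K) (a <ᵇ K) (countTo B (window D′ a))
      ... | no N≰a rewrite window-shift a | ≥⇒<ᵇ≡false {n + M} {a + M} (+-monoˡ-≤ M {a} {n} (s≤s⁻¹ (≰⇒> N≰a)))
                         | >⇒≤ᵇ≡false {N} {a} (≰⇒> N≰a)
                         | sumTo-zero B {λ x → ind (window D′ a x)} (λ x _ → cong ind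
                             (cong ((a ≤ᵇ x) ∧_) (below-K (a + M) (+-monoˡ-≤ M (≤-trans (n≤1+n a) (≰⇒> N≰a))) x (not (D′ x)))
                              ■ ∧-zeroʳ _)) =
            tidy-low (isGenΔ D (suc a)) (isGenΔ D′ a) (D K) (a <ᵇ K) (a <ᵇ N + M)

    cogenFactor-shift : cogenFactor D (suc B) ≡ (if not b ∧ (p ∧ q) then P′ ⊕ mono 0 (- (+ L′)) 1 P′ else P′)
    cogenFactor-shift =
      cong (foldr step oneS) (filterTo-front B _)
      ■ cong (λ z → foldr step oneS ((if z then 0 ∷ [] else []) ++ map suc (dcogensΔ D′ B)))
             (cong₂ (λ u w → not u ∧ w) e0 (cong₂ _∧_ eN eM))
      ■ by-cases (not b ∧ (p ∧ q))
      where
      step : ℕ → Ser → Ser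
      step k F = F ⊕ mono 0 (- (+ lamkΔ D (suc B) k)) 1 F
      by-cases : ∀ z → foldr step oneS ((if z then 0 ∷ [] else []) ++ map suc (dcogensΔ D′ B))
                       ≡ (if z then P′ ⊕ mono 0 (- (+ L′)) 1 P′ else P′)
      by-cases false = cogenFactor-shift-foldr D B (dcogensΔ D′ B)
      by-cases true rewrite cogenFactor-shift-foldr D B (dcogensΔ D′ B) | lamk-zero-shift D B = refl

    contrib-unchanged : r ≡ true → ind (p ∧ not b) ≡ ind (r ∧ not q) → not b ∧ (p ∧ q) ≡ false →
                        contribΔ D (suc B) ≈S contribΔ D′ B
    contrib-unchanged r≡true gens≡ no-dcog = ≡⇒≈S (
      cong₂ (λ A Z → mono A Z 0 (cogenFactor D (suc B)))
            (area-shift ■ cong (λ z → A′ + (if z then 0 else 1)) r≡true ■ +-identityʳ A′)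
            (cong -_ (cong₂ (λ S L → + S ℤ.- + tri L)
                            (weightSum-shift ■ cong (λ z → S′ + (if z then 0 else L′)) r≡true ■ +-identityʳ S′)
                            (lam-head ■ cong (_+ c) gens≡ ■ +-comm _ c ■ sym lam-tail)))
      ■ cong (mono A′ (- codinvΔ D′ B) 0)
             (cogenFactor-shift ■ cong (λ z → if z then P′ ⊕ mono 0 (- (+ L′)) 1 P′ else P′) no-dcog))

    contrib-via : ∀ {a z} → areaΔ D (suc B) ≡ a + A′ → - codinvΔ D (suc B) ≡ z ℤ.+ - codinvΔ D′ B →
                  cogenFactor D (suc B) ≡ P′ → contribΔ D (suc B) ≈S mono a z 0 (contribΔ D′ B)
    contrib-via {a} {z} ea ez ep =
      ≈S-trans (≡⇒≈S (cong₂ (λ A Z → mono A Z 0 (cogenFactor D (suc B))) ea ez ■ cong (mono (a + A′) _ 0) ep))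
               (≈S-sym (mono-mono a z 0 A′ (- codinvΔ D′ B) 0 P′))

  admissible : (b p q r : Bool) → Bool
  admissible b p q r = (not b ∨ (p ∧ q)) ∧ ((not p ∨ r) ∧ (not q ∨ r))

  -- The factor relating the weights of Δ and Δ′, indexed by the bits of 0, N, M, N+M in Δ.
  -- The catch-all clause gives factor 1 (the three remaining admissible patterns) and junk on
  -- inadmissible bits.
  shiftFactor : (b p q r : Bool) → ℕ → Ser → Ser
  shiftFactor false false false false c F = mono 1 (- (+ c)) 0 F
  shiftFactor false false false true  c F = mono 0 (- (+ c)) 0 F
  shiftFactor false true  true  true  c F = mono 0 (+ c) 0 F ⊕ mono 0 (+ 0) 1 F
  shiftFactor _     _     _     _     c F = F

  contrib-shift : ∀ D B → K ≤ B → ∀ {b p q r} → D 0 ≡ b → D N ≡ p → D M ≡ q → D K ≡ r →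
                  admissible b p q r ≡ true →
                  contribΔ D (suc B) ≈S shiftFactor b p q r (innerGens D) (contribΔ (shift D) B)
  contrib-shift D B K≤B {true}  {true}  {true}  {true}  e0 eN eM eK _ =
    contrib-unchanged refl refl refl
    where open ShiftAt D B K≤B e0 eN eM eK
  contrib-shift D B K≤B {false} {true}  {false} {true}  e0 eN eM eK _ =
    contrib-unchanged refl refl refl
    where open ShiftAt D B K≤B e0 eN eM eK
  contrib-shift D B K≤B {false} {false} {true}  {true}  e0 eN eM eK _ =
    contrib-unchanged refl refl refl
    where open ShiftAt D B K≤B e0 eN eM eK
  contrib-shift D B K≤B {false} {false} {false} {true}  e0 eN eM eK _ =
    contrib-via (area-shift ■ +-identityʳ A′) codinv-shift cogenFactor-shift
    where
    open ShiftAt D B K≤B e0 eN eM eK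
    codinv-shift : - codinvΔ D (suc B) ≡ - (+ c) ℤ.+ - codinvΔ D′ B
    codinv-shift =
      cong₂ (λ S L → - (+ S ℤ.- + tri L)) (weightSum-shift ■ +-identityʳ S′) lam-head
      ■ ring (+ S′) (+ tri c) (+ c)
      ■ cong (λ T → - (+ c) ℤ.+ - (+ S′ ℤ.- T)) (sym (tri-suc c) ■ cong (λ l → + tri l) (+-comm 1 c ■ sym lam-tail))
      where
      open import Data.Integer.Tactic.RingSolver using (solve-∀)
      ring : ∀ (s t l : ℤ) → - (s ℤ.- t) ≡ - l ℤ.+ - (s ℤ.- (t ℤ.+ l))
      ring = solve-∀
  contrib-shift D B K≤B {false} {false} {false} {false} e0 eN eM eK _ =
    contrib-via (area-shift ■ +-comm A′ 1) codinv-shift cogenFactor-shift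
    where
    open ShiftAt D B K≤B e0 eN eM eK
    codinv-shift : - codinvΔ D (suc B) ≡ - (+ c) ℤ.+ - codinvΔ D′ B
    codinv-shift =
      cong₂ (λ S L → - (+ S ℤ.- + tri L)) (weightSum-shift ■ cong (_+_ S′) (lam-tail ■ +-identityʳ c)) lam-head
      ■ cong (λ X → - (X ℤ.- + tri c)) (ℤP.pos-+ S′ c)
      ■ ring (+ S′) (+ tri c) (+ c)
      ■ cong (λ l → - (+ c) ℤ.+ - (+ S′ ℤ.- + tri l)) (sym (lam-tail ■ +-identityʳ c))
      where
      open import Data.Integer.Tactic.RingSolver using (solve-∀)
      ring : ∀ (s t l : ℤ) → - ((s ℤ.+ l) ℤ.- t) ≡ - l ℤ.+ - (s ℤ.- t)
      ring = solve-∀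
  contrib-shift D B K≤B {false} {true}  {true}  {true}  e0 eN eM eK _ =
    ≈S-trans (≡⇒≈S (cong₂ (λ A P → mono A z 0 P) (area-shift ■ +-identityʳ A′)
                          (cogenFactor-shift ■ cong (λ l → P′ ⊕ mono 0 (- (+ l)) 1 P′) L′≡c)))
    (≈S-trans (mono-⊕ A′ z 0 P′ (mono 0 (- (+ c)) 1 P′))
    (⊕-cong (≈S-trans (≡⇒≈S (cong (λ Z → mono A′ Z 0 P′) z≡c+z′)) (≈S-sym (mono-mono 0 (+ c) 0 A′ z′ 0 P′)))
            (≈S-trans (mono-mono A′ z 0 0 (- (+ c)) 1 P′)
            (≈S-trans (≡⇒≈S (cong₂ (λ A Z → mono A Z 1 P′) (+-identityʳ A′) z-c≡z′))
                      (≈S-sym (mono-mono 0 (+ 0) 1 A′ z′ 0 P′))))))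
    where
    open ShiftAt D B K≤B e0 eN eM eK
    open import Data.Integer.Tactic.RingSolver using (solve-∀)
    z z′ : ℤ
    z = - codinvΔ D (suc B)
    z′ = - codinvΔ D′ B
    L′≡c : L′ ≡ c
    L′≡c = lam-tail ■ +-identityʳ c
    codinv-expanded : codinvΔ D (suc B) ≡ + S′ ℤ.- (+ tri c ℤ.+ + c)
    codinv-expanded = cong₂ (λ S T → + S ℤ.- T) (weightSum-shift ■ +-identityʳ S′) (cong (λ l → + tri l) lam-head ■ tri-suc c)
    z′-expanded : z′ ≡ - (+ S′ ℤ.- + tri c)
    z′-expanded = cong (λ l → - (+ S′ ℤ.- + tri l)) L′≡c
    ring₁ : ∀ (s t l : ℤ) → - (s ℤ.- (t ℤ.+ l)) ≡ l ℤ.+ - (s ℤ.- t)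
    ring₁ = solve-∀
    ring₂ : ∀ (s t l : ℤ) → - (s ℤ.- (t ℤ.+ l)) ℤ.+ - l ≡ + 0 ℤ.+ - (s ℤ.- t)
    ring₂ = solve-∀
    z≡c+z′ : z ≡ + c ℤ.+ z′
    z≡c+z′ = cong -_ codinv-expanded ■ ring₁ (+ S′) (+ tri c) (+ c) ■ cong (ℤ._+_ (+ c)) (sym z′-expanded)
    z-c≡z′ : z ℤ.+ - (+ c) ≡ + 0 ℤ.+ z′
    z-c≡z′ = cong (λ X → - X ℤ.+ - (+ c)) codinv-expanded ■ ring₂ (+ S′) (+ tri c) (+ c)
             ■ cong (ℤ._+_ (+ 0)) (sym z′-expanded)
  contrib-shift D B K≤B {true}  {true}  {false} {_}     e0 eN eM eK ()
  contrib-shift D B K≤B {true}  {false} {_}     {_}     e0 eN eM eK ()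
  contrib-shift D B K≤B {true}  {true}  {true}  {false} e0 eN eM eK ()
  contrib-shift D B K≤B {false} {true}  {_}     {false} e0 eN eM eK ()
  contrib-shift D B K≤B {false} {false} {true}  {false} e0 eN eM eK ()

  innerLabelsV : Mem → Vec Sym m
  innerLabelsV D = labs m (λ x → symb (D (N + suc x)) (D (suc x)))

  innerLabelsW : Mem → Vec Sym n
  innerLabelsW D = labs n (λ x → symb (D (M + suc x)) (D (suc x)))

  crosses-innerLabels : ∀ D → crosses (innerLabelsV D) ≡ innerGens D
  crosses-innerLabels D = crosses-labs m _ ■ sumTo-cong m (λ i _ → cong ind (isX-sym _ _))

  vOf-prefix : ∀ D → vOf M N (prefix (N + M) D) ≡ labs M (λ x → symb (D (N + x)) (D x))
  vOf-prefix D =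
    tabulate-labs M (λ x → symb (at (prefix (N + M) D) (N + x)) (at (prefix (N + M) D) x))
    ■ labs-cong M (λ x x<M → cong₂ symb (at-prefix (N + M) D (N + x) (+-monoʳ-< N x<M))
                                         (at-prefix (N + M) D x (<-≤-trans x<M (m≤n+m M N))))

  wOf-prefix : ∀ D → wOf M N (prefix (N + M) D) ≡ labs N (λ x → symb (D (M + x)) (D x))
  wOf-prefix D =
    tabulate-labs N (λ x → symb (at (prefix (N + M) D) (M + x)) (at (prefix (N + M) D) x))
    ■ labs-cong N (λ x x<N → cong₂ symb (at-prefix (N + M) D (M + x) (subst (M + x <_) (+-comm M N) (+-monoʳ-< M x<N)))
                                         (at-prefix (N + M) D x (<-≤-trans x<N (m≤m+n N M))))

  labelled-head : ∀ D x v y w → labelled (x ∷ v) (y ∷ w) D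
    ≡ (((symb (D N) (D 0) ==S x) ∧ eqV (innerLabelsV D) v) ∧ ((symb (D M) (D 0) ==S y) ∧ eqV (innerLabelsW D) w))
  labelled-head D x v y w =
    cong₂ (λ a b → eqV a (x ∷ v) ∧ eqV b (y ∷ w)) (vOf-prefix D) (wOf-prefix D)
    ■ cong₂ (λ a b → ((symb (D a) (D 0) ==S x) ∧ eqV (innerLabelsV D) v) ∧ ((symb (D b) (D 0) ==S y) ∧ eqV (innerLabelsW D) w))
            (+-identityʳ N) (+-identityʳ M)

  labelled-last : ∀ D v w x′ y′ → labelled (v ∷ʳ x′) (w ∷ʳ y′) (shift D)
    ≡ ((eqV (innerLabelsV D) v ∧ (symb (D K) (D M) ==S x′)) ∧ (eqV (innerLabelsW D) w ∧ (symb (D K) (D N) ==S y′)))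
  labelled-last D v w x′ y′ =
    cong₂ (λ a b → eqV a (v ∷ʳ x′) ∧ eqV b (w ∷ʳ y′))
          (vOf-prefix (shift D) ■ labs-snoc m fv) (wOf-prefix (shift D) ■ labs-snoc n fw)
    ■ cong₂ _∧_ (eqV-snoc (labs m fv) v (fv m) x′) (eqV-snoc (labs n fw) w (fw n) y′)
    ■ cong₂ (λ a b → (eqV a v ∧ (symb (D (suc (N + m))) (D M) ==S x′)) ∧ (eqV b w ∧ (symb (D (suc (M + n))) (D N) ==S y′)))
            (labs-cong m (λ z _ → cong (λ u → symb (D u) (D (suc z))) (sym (+-suc N z))))
            (labs-cong n (λ z _ → cong (λ u → symb (D u) (D (suc z))) (sym (+-suc M z))))
    ■ cong₂ (λ a b → (eqV (innerLabelsV D) v ∧ (symb (D a) (D M) ==S x′))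
                     ∧ (eqV (innerLabelsW D) w ∧ (symb (D b) (D N) ==S y′)))
            (sym (+-suc N m)) (sym (+-suc M n) ■ +-comm M N)
    where
    fv fw : ℕ → Sym
    fv z = symb (D (suc (N + z))) (D (suc z))
    fw z = symb (D (suc (M + z))) (D (suc z))

  -- p, q, r stand for N, M, N+M ∈ Δ and b for 0 ∈ Δ.
  headOK : Bool → Sym → Sym → (p q : Bool) → Bool
  headOK b x y p q = (not b ∨ (p ∧ q)) ∧ ((symb p b ==S x) ∧ (symb q b ==S y))

  lastOK : Sym → Sym → (p q r : Bool) → Bool
  lastOK x′ y′ p q r = (symb r q ==S x′) ∧ (symb r p ==S y′)

  closure : (p q r : Bool) → Bool
  closure p q r = (not p ∨ r) ∧ (not q ∨ r)

  headSum : Sym → Sym → (p q r : Bool) → ℕ → Ser → Ser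
  headSum x y p q r c F d i j =
    (if headOK true x y p q then shiftFactor true p q r c F d i j else 0)
    + (if headOK false x y p q then shiftFactor false p q r c F d i j else 0)

  lastPart : Sym → Sym → (p q r : Bool) → Ser → Ser
  lastPart x′ y′ p q r G d i j = if lastOK x′ y′ p q r then G d i j else 0

  local-oo : ∀ p q r c F → closure p q r ≡ true →
    headSum o o p q r c F ≈S (lastPart ✗ ✗ p q r (mono 0 (- (+ c)) 0 F) ⊕ lastPart o o p q r (mono 1 (- (+ c)) 0 F))
  local-oo false false false c F _ d i j = refl
  local-oo false false true  c F _ d i j = sym (+-identityʳ _)
  local-oo false true  true  c F _ d i j = refl
  local-oo true  false true  c F _ d i j = refl
  local-oo true  true  true  c F _ d i j = refl
  local-oo false true  false c F ()
  local-oo true  _     false c F ()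

  local-xo : ∀ p q r c F → closure p q r ≡ true → headSum ✗ o p q r c F ≈S lastPart ✗ ● p q r F
  local-xo false false false c F _ d i j = refl
  local-xo false false true  c F _ d i j = refl
  local-xo false true  true  c F _ d i j = refl
  local-xo true  false true  c F _ d i j = refl
  local-xo true  true  true  c F _ d i j = refl
  local-xo false true  false c F ()
  local-xo true  _     false c F ()

  local-ox : ∀ p q r c F → closure p q r ≡ true → headSum o ✗ p q r c F ≈S lastPart ● ✗ p q r F
  local-ox false false false c F _ d i j = refl
  local-ox false false true  c F _ d i j = refl
  local-ox false true  true  c F _ d i j = refl
  local-ox true  false true  c F _ d i j = refl
  local-ox true  true  true  c F _ d i j = refl
  local-ox false true  false c F ()
  local-ox true  _     false c F ()

  local-xx : ∀ p q r c F → closure p q r ≡ true →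
    headSum ✗ ✗ p q r c F ≈S (lastPart ● ● p q r (mono 0 (+ c) 0 F) ⊕ lastPart ● ● p q r (mono 0 (+ 0) 1 F))
  local-xx false false false c F _ d i j = refl
  local-xx false false true  c F _ d i j = refl
  local-xx false true  true  c F _ d i j = refl
  local-xx true  false true  c F _ d i j = refl
  local-xx true  true  true  c F _ d i j = refl
  local-xx false true  false c F ()
  local-xx true  _     false c F ()

  local-●● : ∀ p q r c F → closure p q r ≡ true → headSum ● ● p q r c F ≈S lastPart ● ● p q r F
  local-●● false false false c F _ d i j = refl
  local-●● false false true  c F _ d i j = refl
  local-●● false true  true  c F _ d i j = refl
  local-●● true  false true  c F _ d i j = refl
  local-●● true  true  true  c F _ d i j = +-identityʳ _
  local-●● false true  false c F ()
  local-●● true  _     false c F ()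

  module Slice (d : ℕ) (i : ℤ) (j : ℕ) where

    B : ℕ
    B = bound M N d

    K≤B : K ≤ B
    K≤B = m≤m+n K (d * N)

    p q r : Vec Bool B → Bool
    p t = memV t n
    q t = memV t m
    r t = memV t (n + M)

    tailOK : Vec Sym m → Vec Sym n → Vec Bool B → Bool
    tailOK v w t = inI (memV t) B ∧ (eqV (innerLabelsV (memV (true ∷ t))) v ∧ eqV (innerLabelsW (memV (true ∷ t))) w)

    closure-of-tail : ∀ t → inI (memV t) B ≡ true → closure (p t) (q t) (r t) ≡ true
    closure-of-tail t inΔ = cong₂ _∧_ (closedAt n (m≤m+n N M) (λ both → ∧-≡-trueʳ {memV t (n + N)} both))
                                     (closedAt m (m≤n+m M N)
                                       (λ both → subst (λ u → memV t u ≡ true) m+N≡n+M (∧-≡-trueˡ both)))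
      where
      m+N≡n+M : m + N ≡ n + M
      m+N≡n+M = +-suc m n ■ cong suc (+-comm m n) ■ sym (+-suc n m)
      closedAt : ∀ a → suc a ≤ K → ((memV t (a + N) ∧ memV t (a + M)) ≡ true → r t ≡ true) →
                 (not (memV t a) ∨ r t) ≡ true
      closedAt a a<K then with memV t a | allTo-sound B inΔ a (<-≤-trans a<K K≤B)
      ... | false | _ = refl
      ... | true  | both = then both

    head-summand : ∀ b x v y w t →
      summand (x ∷ v) (y ∷ w) id (suc B) d i j (b ∷ t)
      ≡ (if tailOK v w t ∧ headOK b x y (p t) (q t)
           then shiftFactor b (p t) (q t) (r t) (crosses v) (contribΔ (memV t) B) d i j else 0)
    head-summand b x v y w t =
      if-cong (cong₂ _∧_ (inI-front (memV (b ∷ t)) B) (labelled-head (memV (b ∷ t)) x v y w)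
               ■ shuffle (not b ∨ (p t ∧ q t)) (inI (memV t) B) (symb (p t) b ==S x) tv (symb (q t) b ==S y) tw)
              (λ ok → contrib-shift (memV (b ∷ t)) B K≤B refl refl refl refl (admissible-from ok) d i j
                      ■ cong (λ c → shiftFactor b (p t) (q t) (r t) c (contribΔ (memV t) B) d i j)
                             (sym (crosses-innerLabels (memV (b ∷ t)))
                              ■ cong crosses (eqV-sound (innerLabelsV (memV (b ∷ t))) v
                                    (∧-≡-trueˡ {tv} {tw} (∧-≡-trueʳ {inI (memV t) B} (∧-≡-trueˡ {tailOK v w t} ok))))))
      where
      tv tw : Bool
      tv = eqV (innerLabelsV (memV (true ∷ t))) v
      tw = eqV (innerLabelsW (memV (true ∷ t))) w
      shuffle : ∀ a I e₁ t₁ e₂ t₂ →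
                ((a ∧ I) ∧ ((e₁ ∧ t₁) ∧ (e₂ ∧ t₂))) ≡ ((I ∧ (t₁ ∧ t₂)) ∧ (a ∧ (e₁ ∧ e₂)))
      shuffle a I e₁ t₁ e₂ t₂ =
        cong ((a ∧ I) ∧_) (∧-interchange e₁ t₁ e₂ t₂) ■ ∧-interchange a I (e₁ ∧ e₂) (t₁ ∧ t₂)
        ■ ∧-comm (a ∧ (e₁ ∧ e₂)) (I ∧ (t₁ ∧ t₂))
      admissible-from : (tailOK v w t ∧ headOK b x y (p t) (q t)) ≡ true → admissible b (p t) (q t) (r t) ≡ true
      admissible-from ok =
        cong₂ _∧_ (∧-≡-trueˡ {not b ∨ (p t ∧ q t)} (∧-≡-trueʳ {tailOK v w t} ok))
                  (closure-of-tail t (∧-≡-trueˡ {inI (memV t) B} (∧-≡-trueˡ {tailOK v w t} ok)))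

    head-pair : ∀ x v y w t →
      summand (x ∷ v) (y ∷ w) id (suc B) d i j (true ∷ t) + summand (x ∷ v) (y ∷ w) id (suc B) d i j (false ∷ t)
      ≡ (if tailOK v w t then headSum x y (p t) (q t) (r t) (crosses v) (contribΔ (memV t) B) d i j else 0)
    head-pair x v y w t = cong₂ _+_ (head-summand true x v y w t) (head-summand false x v y w t)
                          ■ if-∧-+ (tailOK v w t) (headOK true x y (p t) (q t)) (headOK false x y (p t) (q t)) _ _

    last-summand : ∀ v w x′ y′ F t → summand (v ∷ʳ x′) (w ∷ʳ y′) F B d i j t
      ≡ (if tailOK v w t then lastPart x′ y′ (p t) (q t) (r t) (F (contribΔ (memV t) B)) d i j else 0)
    last-summand v w x′ y′ F t =
      cong (λ z → if z then F (contribΔ (memV t) B) d i j else 0)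
           (cong (inI (memV t) B ∧_) (labelled-last (memV (true ∷ t)) v w x′ y′)
            ■ ∧-interchange-last (inI (memV t) B) (eqV (innerLabelsV (memV (true ∷ t))) v) (symb (r t) (q t) ==S x′)
                                 (eqV (innerLabelsW (memV (true ∷ t))) w) (symb (r t) (p t) ==S y′))
      ■ if-∧ (tailOK v w t) _ _
      where
      ∧-interchange-last : ∀ I t₁ e₁ t₂ e₂ →
                           (I ∧ ((t₁ ∧ e₁) ∧ (t₂ ∧ e₂))) ≡ ((I ∧ (t₁ ∧ t₂)) ∧ (e₁ ∧ e₂))
      ∧-interchange-last I t₁ e₁ t₂ e₂ = cong (I ∧_) (∧-interchange t₁ e₁ t₂ e₂) ■ sym (∧-assoc I _ _)

    head-split : ∀ x v y w → QVW M N (x ∷ v) (y ∷ w) d i j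
      ≡ sumList (allVecs B) (λ t → summand (x ∷ v) (y ∷ w) id (suc B) d i j (true ∷ t)
                                   + summand (x ∷ v) (y ∷ w) id (suc B) d i j (false ∷ t))
    head-split x v y w =
      QVW-as-QΔ (x ∷ v) (y ∷ w) d i j
      ■ QΔ-stable (x ∷ v) (y ∷ w) d i j (suc B) (n≤1+n B)
      ■ allVecs-cons-split B _
      ■ sym (sumList-+ (allVecs B) _ _)

    recursion-single : ∀ x y x′ y′ v w →
      (∀ p q r c F → closure p q r ≡ true → headSum x y p q r c F ≈S lastPart x′ y′ p q r F) →
      QVW M N (x ∷ v) (y ∷ w) d i j ≡ QVW M N (v ∷ʳ x′) (w ∷ʳ y′) d i j
    recursion-single x y x′ y′ v w local =
      head-split x v y w
      ■ sumList-cong (allVecs B) (λ t →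
          head-pair x v y w t
          ■ if-cong refl (λ ok → local (p t) (q t) (r t) (crosses v) (contribΔ (memV t) B)
                                       (closure-of-tail t (∧-≡-trueˡ {inI (memV t) B} ok)) d i j)
          ■ sym (last-summand v w x′ y′ id t))
      ■ sym (QVW-as-QΔ (v ∷ʳ x′) (w ∷ʳ y′) d i j)

    recursion-pair : ∀ x y v w x₁ y₁ F₁ x₂ y₂ F₂ →
      (∀ p q r F → closure p q r ≡ true →
         headSum x y p q r (crosses v) F ≈S (lastPart x₁ y₁ p q r (F₁ F) ⊕ lastPart x₂ y₂ p q r (F₂ F))) →
      QVW M N (x ∷ v) (y ∷ w) d i j
      ≡ sumList (allVecs B) (summand (v ∷ʳ x₁) (w ∷ʳ y₁) F₁ B d i j)
        + sumList (allVecs B) (summand (v ∷ʳ x₂) (w ∷ʳ y₂) F₂ B d i j)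
    recursion-pair x y v w x₁ y₁ F₁ x₂ y₂ F₂ local =
      head-split x v y w
      ■ sumList-cong (allVecs B) (λ t →
          head-pair x v y w t
          ■ if-cong refl (λ ok → local (p t) (q t) (r t) (contribΔ (memV t) B)
                                 (closure-of-tail t (∧-≡-trueˡ {inI (memV t) B} ok)) d i j)
          ■ if-+ (tailOK v w t) _ _
          ■ sym (cong₂ _+_ (last-summand v w x₁ y₁ F₁ t) (last-summand v w x₂ y₂ F₂ t)))
      ■ sumList-+ (allVecs B) _ _

  module _ (v : Vec Sym m) (w : Vec Sym n) where

    recursion-oo : QVW M N (o ∷ v) (o ∷ w)
      ≈S mono 0 (- (+ crosses v)) 0 (QVW M N (v ∷ʳ ✗) (w ∷ʳ ✗)) ⊕ mono 1 (- (+ crosses v)) 0 (QVW M N (v ∷ʳ o) (w ∷ʳ o))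
    recursion-oo d i j =
      Slice.recursion-pair d i j o o v w ✗ ✗ (mono 0 (- (+ crosses v)) 0) o o (mono 1 (- (+ crosses v)) 0)
        (λ p q r → local-oo p q r (crosses v))
      ■ sym (cong₂ _+_ (mono-QVW 0 (- (+ crosses v)) 0 (v ∷ʳ ✗) (w ∷ʳ ✗) d i j)
                       (mono-QVW 1 (- (+ crosses v)) 0 (v ∷ʳ o) (w ∷ʳ o) d i j))

    recursion-xo : QVW M N (✗ ∷ v) (o ∷ w) ≈S QVW M N (v ∷ʳ ✗) (w ∷ʳ ●)
    recursion-xo d i j = Slice.recursion-single d i j ✗ o ✗ ● v w local-xo

    recursion-ox : QVW M N (o ∷ v) (✗ ∷ w) ≈S QVW M N (v ∷ʳ ●) (w ∷ʳ ✗)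
    recursion-ox d i j = Slice.recursion-single d i j o ✗ ● ✗ v w local-ox

    recursion-xx : QVW M N (✗ ∷ v) (✗ ∷ w)
      ≈S mono 0 (+ crosses v) 0 (QVW M N (v ∷ʳ ●) (w ∷ʳ ●)) ⊕ mono 0 (+ 0) 1 (QVW M N (v ∷ʳ ●) (w ∷ʳ ●))
    recursion-xx d i j =
      Slice.recursion-pair d i j ✗ ✗ v w ● ● (mono 0 (+ crosses v) 0) ● ● (mono 0 (+ 0) 1)
        (λ p q r → local-xx p q r (crosses v))
      ■ sym (cong₂ _+_ (mono-QVW 0 (+ crosses v) 0 (v ∷ʳ ●) (w ∷ʳ ●) d i j)
                       (mono-QVW 0 (+ 0) 1 (v ∷ʳ ●) (w ∷ʳ ●) d i j))

    recursion-●● : QVW M N (● ∷ v) (● ∷ w) ≈S QVW M N (v ∷ʳ ●) (w ∷ʳ ●)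
    recursion-●● d i j = Slice.recursion-single d i j ● ● ● ● v w local-●●

mainTheorem14 : (m n : ℕ) (v : Vec Sym m) (w : Vec Sym n) →
    (QVW (suc m) (suc n) (o ∷ v) (o ∷ w)
      ≈S mono 0 (- (+ crosses v)) 0 (QVW (suc m) (suc n) (v ∷ʳ ✗) (w ∷ʳ ✗))
         ⊕ mono 1 (- (+ crosses v)) 0 (QVW (suc m) (suc n) (v ∷ʳ o) (w ∷ʳ o)))
  × (QVW (suc m) (suc n) (✗ ∷ v) (o ∷ w) ≈S QVW (suc m) (suc n) (v ∷ʳ ✗) (w ∷ʳ ●))
  × (QVW (suc m) (suc n) (o ∷ v) (✗ ∷ w) ≈S QVW (suc m) (suc n) (v ∷ʳ ●) (w ∷ʳ ✗))
  × (QVW (suc m) (suc n) (✗ ∷ v) (✗ ∷ w)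
      ≈S mono 0 (+ crosses v) 0 (QVW (suc m) (suc n) (v ∷ʳ ●) (w ∷ʳ ●))
         ⊕ mono 0 (+ 0) 1 (QVW (suc m) (suc n) (v ∷ʳ ●) (w ∷ʳ ●)))
  × (QVW (suc m) (suc n) (● ∷ v) (● ∷ w) ≈S QVW (suc m) (suc n) (v ∷ʳ ●) (w ∷ʳ ●))
mainTheorem14 m n v w = recursion-oo v w , recursion-xo v w , recursion-ox v w , recursion-xx v w , recursion-●● v w
  where open Recursion m n using (recursion-oo; recursion-xo; recursion-ox; recursion-xx; recursion-●●)
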